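{- Every special numerical semigroup $S$ satisfies Wilf's inequality $\operatorname{e}(S)\operatorname{n}(S)\ge \operatorname{F}(S)+1$.
   Context: $\mathbb{N}=\{0,1,2,\ldots\}$. A numerical semigroup is a submonoid $S$ of $(\mathbb{N},+)$ with $\mathbb{N}\setminus S$ finite. $\operatorname{H}(S)=\mathbb{N}\setminus S$; $\operatorname{F}(S)=\max\operatorname{H}(S)$ ($\operatorname{F}(\mathbb{N})=-1$); $\operatorname{m}(S)=\min(S\setminus\{0\})$; $\operatorname{n}(S)=|\{s\in S\mid s<\operatorname{F}(S)\}|$ ($\operatorname{n}(\mathbb{N})=1$); $\operatorname{e}(S)$ is the number of minimal generators of $S$. Special gaps: $\operatorname{SG}(S)=\{h\in\operatorname{H}(S)\mid 2h\in S \text{ and } h+s\in S \text{ for all } s\in S\setminus\{0\}\}$. $S$ is special if there is no $h\in\operatorname{SG}(S)\setminus\{\operatorname{F}(S)\}$ with $h>\operatorname{m}(S)$. -}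

module Defs where

open import Data.Nat using (ℕ; zero; suc; _+_; _*_; _≤_; _<_)
open import Data.Integer using (ℤ; +_; -[1+_])
open import Data.List using (List; length)
open import Data.List.Membership.Propositional using (_∈_)
open import Data.List.Relation.Unary.All using (All)
open import Data.List.Relation.Unary.Unique.Propositional using (Unique)
open import Data.Product using (Σ; _×_; ∃; ∃-syntax)
open import Data.Sum using (_⊎_)
open import Relation.Binary.PropositionalEquality using (_≡_; _≢_)
open import Relation.Nullary using (¬_; Dec)
open import Data.Empty using (⊥)

-- A numerical semigroup: a submonoid of (ℕ,+) with finite complement.
-- Membership is decidable (automatic classically, since the complement is finite).
record NumericalSemigroup : Set₁ where
  field
    _∈S     : ℕ → Set
    dec     : (x : ℕ) → Dec (x ∈S)
    zero∈   : 0 ∈S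
    closed  : ∀ x y → x ∈S → y ∈S → (x + y) ∈S
    cofinite : ∃[ B ] (∀ x → B ≤ x → x ∈S)

open NumericalSemigroup public

_∈ₛ_ : ℕ → NumericalSemigroup → Set
x ∈ₛ S = _∈S S x

Gap : NumericalSemigroup → ℕ → Set
Gap S h = ¬ (h ∈ₛ S)

IsFrobenius : NumericalSemigroup → ℤ → Set
IsFrobenius S f =
  (f ≡ -[1+ 0 ] × (∀ x → Gap S x → ⊥))
  ⊎ (Σ ℕ λ h → f ≡ + h × Gap S h × (∀ x → Gap S x → x ≤ h))

IsMultiplicity : NumericalSemigroup → ℕ → Set
IsMultiplicity S m = m ∈ₛ S × m ≢ 0 × (∀ s → s ∈ₛ S → s ≢ 0 → m ≤ s)

HasCard : (ℕ → Set) → ℕ → Set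
HasCard P k = Σ (List ℕ) λ l → Unique l × (∀ x → (x ∈ l → P x) × (P x → x ∈ l)) × length l ≡ k

IsN : NumericalSemigroup → ℤ → ℕ → Set
IsN S f k =
  (f ≡ -[1+ 0 ] × k ≡ 1)
  ⊎ (Σ ℕ λ F → f ≡ + F × HasCard (λ s → s ∈ₛ S × s < F) k)

data ⟨_⟩ (A : ℕ → Set) : ℕ → Set where
  gen-zero : ⟨ A ⟩ 0
  gen-add  : ∀ {a x} → A a → ⟨ A ⟩ x → ⟨ A ⟩ (a + x)

-- A generates S : A ⊆ S and S ⊆ ⟨A⟩  (⟨A⟩ ⊆ S follows from closure).
Generates : NumericalSemigroup → (ℕ → Set) → Set
Generates S A = (∀ a → A a → a ∈ₛ S) × (∀ s → s ∈ₛ S → ⟨ A ⟩ s)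

MinimalGeneratingSystem : NumericalSemigroup → List ℕ → Set₁
MinimalGeneratingSystem S A =
  Unique A
  × Generates S (λ x → x ∈ A)
  × ((B : ℕ → Set) → (∀ x → B x → x ∈ A) → (∃[ a ] (a ∈ A × ¬ B a)) → ¬ Generates S B)

IsEmbeddingDimension : NumericalSemigroup → ℕ → Set₁
IsEmbeddingDimension S k = Σ (List ℕ) λ A → MinimalGeneratingSystem S A × length A ≡ k

SpecialGap : NumericalSemigroup → ℕ → Set
SpecialGap S h = Gap S h × (2 * h) ∈ₛ S × (∀ s → s ∈ₛ S → s ≢ 0 → (h + s) ∈ₛ S)

IsSpecial : NumericalSemigroup → Set
IsSpecial S = ∀ f m h → IsFrobenius S f → IsMultiplicity S m → SpecialGap S h
              → + h ≢ f → ¬ (m < h)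

-- Let m be the multiplicity and F the Frobenius number; F ≠ 2m because 2m ∈ S.
-- If F < 2m, speciality puts every integer of (m, F) into S, so n = F − m + 1 when m < F,
-- while every nonzero element of S below 2m is a minimal generator, and so is 2m + 1 when
-- F = m + 1; this gives e ≥ m − 1, and e ≥ m when F < m or F = m + 1.
-- If 2m < F, speciality gives F − x ∈ S for every gap x with 2x ≠ F, so x ↦ F − x covers
-- [0, F] by two copies of S ∩ [0, F) except possibly F/2: F + 1 ≤ 2n, or F ≤ 2n when F/2 is
-- a gap. A gap F/2 is a pseudo-Frobenius number whose double is a gap, which forces e ≥ 3;
-- and e ≥ 2 always, F being pseudo-Frobenius.

module Submission where

open import Defs

module Wilf where
  open import Data.Nat
  open import Data.Nat.Properties
  open import Data.Nat.Induction using (<-rec)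
  open import Data.Nat.Solver using (module +-*-Solver)
  import Data.Integer as ℤ
  open import Data.List using (List; []; _∷_; length; map; _++_; upTo; applyUpTo)
  open import Data.List.Properties using (length-++; length-map; length-++-sucʳ; length-applyUpTo; length-upTo)
  open import Data.List.Membership.Propositional using (_∈_)
  open import Data.List.Membership.Propositional.Properties
    using (∈-∃++; ∈-++⁺ˡ; ∈-++⁺ʳ; ∈-++⁻; ∈-map⁺; ∈-applyUpTo⁻; ∈-upTo⁻)
  open import Data.List.Relation.Binary.Subset.Propositional using (_⊆_)
  open import Data.List.Relation.Unary.Any using (here; there)
  open import Data.List.Relation.Unary.All as All using ([]; _∷_)
  open import Data.List.Relation.Unary.AllPairs using ([]; _∷_)
  open import Data.List.Relation.Unary.Unique.Propositional using (Unique)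
  open import Data.List.Relation.Unary.Unique.Propositional.Properties using (++⁺; applyUpTo⁺₁; upTo⁺)
  open import Data.Product using (∃; ∃₂; _×_; _,_; proj₁; proj₂)
  open import Data.Sum using (_⊎_; inj₁; inj₂)
  open import Function using (_∘_)
  open import Relation.Nullary using (¬_; yes; no; contradiction)
  open import Relation.Nullary.Decidable using (_×-dec_; ¬?)
  open import Relation.Unary using (Decidable)
  open import Relation.Binary.PropositionalEquality
  open import Relation.Binary.Definitions using (tri<; tri≈; tri>)

  Unique⇒length-≤ : ∀ {a} {A : Set a} {xs ys : List A} → Unique xs → xs ⊆ ys → length xs ≤ length ys
  Unique⇒length-≤ {xs = []} _ _ = z≤n
  Unique⇒length-≤ {xs = x ∷ xs} (x∉xs ∷ xs-unique) xs⊆ys with us , vs , refl ← ∈-∃++ (xs⊆ys (here refl)) =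
    begin
      suc (length xs)         ≤⟨ s≤s (Unique⇒length-≤ xs-unique xs⊆us++vs) ⟩
      suc (length (us ++ vs)) ≡⟨ length-++-sucʳ us x vs ⟨
      length (us ++ x ∷ vs)   ∎
    where
      open ≤-Reasoning
      xs⊆us++vs : xs ⊆ us ++ vs
      xs⊆us++vs {y} y∈xs with ∈-++⁻ us (xs⊆ys (there y∈xs))
      ... | inj₁ y∈us         = ∈-++⁺ˡ y∈us
      ... | inj₂ (here refl)  = contradiction refl (All.lookup x∉xs y∈xs)
      ... | inj₂ (there y∈vs) = ∈-++⁺ʳ us y∈vs

  interval : ℕ → ℕ → List ℕ
  interval a k = applyUpTo (a +_) k

  interval-unique : ∀ a k → Unique (interval a k)
  interval-unique a k = applyUpTo⁺₁ (a +_) k (λ i<j _ → <⇒≢ (+-monoʳ-< a i<j))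

  ∈-interval⁻ : ∀ {a k x} → x ∈ interval a k → a ≤ x × x < a + k
  ∈-interval⁻ {a} x∈ with i , i<k , refl ← ∈-applyUpTo⁻ (a +_) x∈ = m≤m+n a i , +-monoʳ-< a i<k

  +-cancel-crossed : ∀ q a b y z → q + a ≡ b + y → q + b ≡ a + z → q + q ≡ y + z
  +-cancel-crossed q a b y z q+a≡b+y q+b≡a+z = +-cancelʳ-≡ (a + b) (q + q) (y + z) (begin
    (q + q) + (a + b) ≡⟨ solve 3 (λ q a b → (q :+ q) :+ (a :+ b) := (q :+ a) :+ (q :+ b)) refl q a b ⟩
    (q + a) + (q + b) ≡⟨ cong₂ _+_ q+a≡b+y q+b≡a+z ⟩
    (b + y) + (a + z) ≡⟨ solve 4 (λ a b y z → (b :+ y) :+ (a :+ z) := (y :+ z) :+ (a :+ b)) refl a b y z ⟩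
    (y + z) + (a + b) ∎)
    where
      open ≡-Reasoning
      open +-*-Solver

  module _ {p} {P : ℕ → Set p} (P? : Decidable P) where

    Least : Set p
    Least = ∃ λ k → P k × ∀ j → j < k → ¬ P j

    least-below : ∀ n → Least ⊎ (∀ j → j < n → ¬ P j)
    least-below zero = inj₂ (λ _ ())
    least-below (suc n) with least-below n
    ... | inj₁ least = inj₁ least
    ... | inj₂ none with P? n
    ...   | yes Pn = inj₁ (n , Pn , none)
    ...   | no ¬Pn = inj₂ none≤n
      where
        none≤n : ∀ j → j < suc n → ¬ P j
        none≤n j j<1+n with m<1+n⇒m<n∨m≡n j<1+n
        ... | inj₁ j<n  = none j j<n
        ... | inj₂ refl = ¬Pn

    least : ∀ {n} → P n → Least
    least {n} Pn with least-below (suc n)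
    ... | inj₁ found = found
    ... | inj₂ none  = contradiction Pn (none n ≤-refl)

  PseudoFrobenius : NumericalSemigroup → ℕ → Set
  PseudoFrobenius S q = Gap S q × (∀ s → s ∈ₛ S → s ≢ 0 → (q + s) ∈ₛ S)

  module _ (S : NumericalSemigroup) where

    gap⇒≢0 : ∀ {x} → Gap S x → x ≢ 0
    gap⇒≢0 x∉S refl = x∉S (zero∈ S)

    multiplicity : ∃ (IsMultiplicity S)
    multiplicity =
      let B , B≤⇒∈S = cofinite S
          m , (m∈S , m≢0) , minimal =
            least (λ x → dec S x ×-dec ¬? (x ≟ 0)) {suc B} (B≤⇒∈S (suc B) (n≤1+n B) , λ ())
      in m , m∈S , m≢0 , λ s s∈S s≢0 → ≮⇒≥ (λ s<m → minimal s s<m (s∈S , s≢0))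

    ⟨⟩⊆ : ∀ {A x} → (∀ a → A a → a ∈ₛ S) → ⟨ A ⟩ x → x ∈ₛ S
    ⟨⟩⊆ A⊆S gen-zero         = zero∈ S
    ⟨⟩⊆ A⊆S (gen-add Aa ⟨A⟩x) = closed S _ _ (A⊆S _ Aa) (⟨⟩⊆ A⊆S ⟨A⟩x)

    ⟨⟩-split : ∀ {A x} → (∀ a → A a → a ∈ₛ S) → ⟨ A ⟩ x → x ≢ 0 →
               ∃₂ λ a y → A a × a ≢ 0 × y ∈ₛ S × x ≡ a + y
    ⟨⟩-split A⊆S gen-zero 0≢0 = contradiction refl 0≢0
    ⟨⟩-split A⊆S (gen-add {a} {y} Aa ⟨A⟩y) a+y≢0 with a ≟ 0
    ... | yes refl = ⟨⟩-split A⊆S ⟨A⟩y a+y≢0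
    ... | no a≢0   = a , y , Aa , a≢0 , ⟨⟩⊆ A⊆S ⟨A⟩y , refl

    Decomposable : ℕ → Set
    Decomposable x = ∃₂ λ s t → s ∈ₛ S × t ∈ₛ S × s ≢ 0 × t ≢ 0 × s + t ≡ x

    Atom : ℕ → Set
    Atom x = x ∈ₛ S × x ≢ 0 × ¬ Decomposable x

    generators⊇atoms : ∀ {A x} → Generates S A → Atom x → A x
    generators⊇atoms {A} (A⊆S , S⊆⟨A⟩) (x∈S , x≢0 , indecomposable)
      with a , y , Aa , a≢0 , y∈S , refl ← ⟨⟩-split A⊆S (S⊆⟨A⟩ _ x∈S) x≢0
      with y ≟ 0
    ... | yes refl = subst A (sym (+-identityʳ a)) Aa
    ... | no y≢0   = contradiction (a , y , A⊆S a Aa , y∈S , a≢0 , y≢0 , refl) indecomposable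

    nonzero-generator : ∀ {A} → Generates S A → ∃ λ a → A a × a ≢ 0
    nonzero-generator (A⊆S , S⊆⟨A⟩) =
      let B , B≤⇒∈S = cofinite S
          a , _ , Aa , a≢0 , _ = ⟨⟩-split A⊆S (S⊆⟨A⟩ (suc B) (B≤⇒∈S (suc B) (n≤1+n B))) (λ ())
      in a , Aa , a≢0

    pseudoFrobenius-split : ∀ {A q c} → Generates S A → PseudoFrobenius S q → c ∈ₛ S → c ≢ 0 →
                            ∃₂ λ a y → A a × a ≢ 0 × a ≢ c × y ∈ₛ S × q + c ≡ a + y
    pseudoFrobenius-split {q = q} {c} (A⊆S , S⊆⟨A⟩) (q∉S , q+S⊆S) c∈S c≢0
      with a , y , Aa , a≢0 , y∈S , q+c≡a+y ← ⟨⟩-split A⊆S (S⊆⟨A⟩ _ (q+S⊆S _ c∈S c≢0)) (c≢0 ∘ m+n≡0⇒n≡0 q)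
      = a , y , Aa , a≢0 , a≢c , y∈S , q+c≡a+y
      where
        a≢c : a ≢ c
        a≢c refl = q∉S (subst (_∈ₛ S) (sym (+-cancelʳ-≡ a q y (trans q+c≡a+y (+-comm a y)))) y∈S)

    module _ {A : List ℕ} (generates : Generates S (_∈ A)) {q : ℕ} (pf : PseudoFrobenius S q) where

      private
        ∈A⇒∈S : ∀ {a} → a ∈ A → a ∈ₛ S
        ∈A⇒∈S = proj₁ generates _

      pseudoFrobenius⇒2≤length : 2 ≤ length A
      pseudoFrobenius⇒2≤length =
        let a₀ , a₀∈A , a₀≢0 = nonzero-generator generates
            a₁ , _ , a₁∈A , _ , a₁≢a₀ , _ = pseudoFrobenius-split generates pf (∈A⇒∈S a₀∈A) a₀≢0
        in Unique⇒length-≤ ((a₁≢a₀ ∷ []) ∷ [] ∷ []) (All.lookup (a₁∈A ∷ a₀∈A ∷ []))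

      -- a₂ = a₀ is impossible: adding q + a₀ = a₁ + y and q + a₁ = a₀ + z gives 2q = y + z ∈ S.
      pseudoFrobenius⇒3≤length : Gap S (q + q) → 3 ≤ length A
      pseudoFrobenius⇒3≤length q+q∉S
        with a₀ , a₀∈A , a₀≢0 ← nonzero-generator generates
        with a₁ , y , a₁∈A , a₁≢0 , a₁≢a₀ , y∈S , q+a₀≡a₁+y ← pseudoFrobenius-split generates pf (∈A⇒∈S a₀∈A) a₀≢0
        with a₂ , z , a₂∈A , _ , a₂≢a₁ , z∈S , q+a₁≡a₂+z ← pseudoFrobenius-split generates pf (∈A⇒∈S a₁∈A) a₁≢0
        = Unique⇒length-≤ ((a₂≢a₁ ∷ a₂≢a₀ ∷ []) ∷ (a₁≢a₀ ∷ []) ∷ [] ∷ []) (All.lookup (a₂∈A ∷ a₁∈A ∷ a₀∈A ∷ []))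
        where
          a₂≢a₀ : a₂ ≢ a₀
          a₂≢a₀ refl = q+q∉S (subst (_∈ₛ S) (sym (+-cancel-crossed q a₀ a₁ y z q+a₀≡a₁+y q+a₁≡a₂+z))
                                         (closed S y z y∈S z∈S))

  wilf-bound-when-a≡1 : ∀ {m F} r e n → m ≡ suc (1 + r) → F ≡ m + 1 → suc (1 + r) ≤ e → 2 ≤ n → F + 1 ≤ e * n
  wilf-bound-when-a≡1 r e n refl refl 2+r≤e 2≤n = begin
    (2 + r) + 1 + 1     ≡⟨ +-assoc (2 + r) 1 1 ⟩
    (2 + r) + 2         ≤⟨ +-monoʳ-≤ (2 + r) (m≤m+n 2 r) ⟩
    (2 + r) + (2 + r)   ≡⟨ solve 1 (λ x → x :+ x := x :* con 2) refl (2 + r) ⟩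
    (2 + r) * 2         ≤⟨ *-mono-≤ 2+r≤e 2≤n ⟩
    e * n               ∎
    where
      open ≤-Reasoning
      open +-*-Solver

  wilf-bound-when-2≤a : ∀ {m F} a r e n → m ≡ suc (a + r) → F ≡ m + a → 2 ≤ a → a + r ≤ e → suc a ≤ n →
                        F + 1 ≤ e * n
  wilf-bound-when-2≤a a r e n refl refl 2≤a a+r≤e 1+a≤n = begin
    suc (a + r) + a + 1               ≡⟨ solve 2 (λ a r → con 1 :+ (a :+ r) :+ a :+ con 1 := (a :+ r) :+ (a :+ con 2))
                                                 refl a r ⟩
    (a + r) + (a + 2)                 ≤⟨ +-monoʳ-≤ (a + r) (+-mono-≤ (m≤m+n a r) (≤-trans 2≤a (m≤m+n a r))) ⟩
    (a + r) + ((a + r) + (a + r))     ≡⟨ solve 1 (λ x → x :+ (x :+ x) := x :* con 3) refl (a + r) ⟩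
    (a + r) * 3                       ≤⟨ *-mono-≤ a+r≤e (≤-trans (s≤s 2≤a) 1+a≤n) ⟩
    e * n                             ∎
    where
      open ≤-Reasoning
      open +-*-Solver

  module Special (S : NumericalSemigroup) (special : IsSpecial S)
                 {F : ℕ} (F∉S : Gap S F) (gap⇒≤F : ∀ x → Gap S x → x ≤ F)
                 {m : ℕ} (mult : IsMultiplicity S m)
                 {A : List ℕ} (generates : Generates S (_∈ A))
                 {l : List ℕ} (enumerates : ∀ x → (x ∈ l → x ∈ₛ S × x < F) × (x ∈ₛ S × x < F → x ∈ l)) where

    e n : ℕ
    e = length A
    n = length l

    m∈S : m ∈ₛ S
    m∈S = proj₁ mult

    0<m : 0 < m
    0<m = n≢0⇒n>0 (proj₁ (proj₂ mult))

    m≤ : ∀ {s} → s ∈ₛ S → s ≢ 0 → m ≤ s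
    m≤ = proj₂ (proj₂ mult) _

    F<⇒∈S : ∀ {x} → F < x → x ∈ₛ S
    F<⇒∈S {x} F<x with dec S x
    ... | yes x∈S = x∈S
    ... | no x∉S  = contradiction (gap⇒≤F x x∉S) (<⇒≱ F<x)

    F<x+x⇒2x∈S : ∀ {x} → F < x + x → (2 * x) ∈ₛ S
    F<x+x⇒2x∈S {x} F<x+x = F<⇒∈S (subst (F <_) (cong (x +_) (sym (+-identityʳ x))) F<x+x)

    F-pseudoFrobenius : PseudoFrobenius S F
    F-pseudoFrobenius = F∉S , λ s _ s≢0 → F<⇒∈S (m<m+n F (n≢0⇒n>0 s≢0))

    special-gap⇒≤m : ∀ {g} → SpecialGap S g → g < F → g ≤ m
    special-gap⇒≤m sg g<F =
      ≮⇒≥ (special (ℤ.+ F) m _ (inj₂ (F , refl , F∉S , gap⇒≤F)) mult sg λ { refl → <-irrefl refl g<F })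

    below-2m⇒indecomposable : ∀ {x} → x < m + m → ¬ Decomposable S x
    below-2m⇒indecomposable x<2m (s , t , s∈S , t∈S , s≢0 , t≢0 , refl) =
      <⇒≱ x<2m (+-mono-≤ (m≤ s∈S s≢0) (m≤ t∈S t≢0))

    atoms⇒≤e : ∀ {xs} → Unique xs → (∀ {x} → x ∈ xs → Atom S x) → length xs ≤ e
    atoms⇒≤e xs-unique xs-atoms = Unique⇒length-≤ xs-unique (generators⊇atoms S generates ∘ xs-atoms)

    elements<F⇒≤n : ∀ {xs} → Unique xs → (∀ {x} → x ∈ xs → x ∈ₛ S × x < F) → length xs ≤ n
    elements<F⇒≤n xs-unique xs⊆ = Unique⇒length-≤ xs-unique (proj₂ (enumerates _) ∘ xs⊆)

    1≤n : 1 ≤ n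
    1≤n = elements<F⇒≤n ([] ∷ []) λ { (here refl) → zero∈ S , n≢0⇒n>0 (gap⇒≢0 S F∉S) }

    module BelowTwiceMultiplicity (F<2m : F < m + m) where

      m≤x<F⇒∈S : ∀ {x} → m ≤ x → x < F → x ∈ₛ S
      m≤x<F⇒∈S {x} m≤x x<F with dec S x
      ... | yes x∈S = x∈S
      ... | no x∉S  = subst (_∈ₛ S) (≤-antisym m≤x x≤m) m∈S
        where
          m+m≤x+s : ∀ {s} → s ∈ₛ S → s ≢ 0 → m + m ≤ x + s
          m+m≤x+s s∈S s≢0 = +-mono-≤ m≤x (m≤ s∈S s≢0)
          x≤m : x ≤ m
          x≤m = special-gap⇒≤m
            (x∉S , F<x+x⇒2x∈S {x} (<-≤-trans F<2m (+-mono-≤ m≤x m≤x)) ,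
             λ s s∈S s≢0 → F<⇒∈S (<-≤-trans F<2m (m+m≤x+s s∈S s≢0)))
            x<F

      wilf-F<m : F < m → F + 1 ≤ e * n
      wilf-F<m F<m = begin
        F + 1                  ≡⟨ +-comm F 1 ⟩
        suc F                  ≤⟨ F<m ⟩
        m                      ≡⟨ length-applyUpTo (m +_) m ⟨
        length (interval m m)  ≤⟨ atoms⇒≤e (interval-unique m m) interval-atoms ⟩
        e                      ≡⟨ *-identityʳ e ⟨
        e * 1                  ≤⟨ *-monoʳ-≤ e 1≤n ⟩
        e * n                  ∎
        where
          open ≤-Reasoning
          interval-atoms : ∀ {x} → x ∈ interval m m → Atom S x
          interval-atoms x∈ =
            let m≤x , x<2m = ∈-interval⁻ x∈
                F<x = <-≤-trans F<m m≤x
            in F<⇒∈S F<x , m<n⇒n≢0 F<x , below-2m⇒indecomposable x<2m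

      summand≤m : ∀ {u v} → F ≡ suc m → u ∈ₛ S → m ≤ v → u + v ≡ suc (m + m) → u ≤ m
      summand≤m {u} F≡1+m u∈S m≤v u+v≡1+2m = m<1+n⇒m≤n (≤∧≢⇒< u≤1+m u≢1+m)
        where
          u≤1+m : u ≤ suc m
          u≤1+m = +-cancelʳ-≤ m u (suc m) (≤-trans (+-monoʳ-≤ u m≤v) (≤-reflexive u+v≡1+2m))
          u≢1+m : u ≢ suc m
          u≢1+m u≡1+m = F∉S (subst (_∈ₛ S) (trans u≡1+m (sym F≡1+m)) u∈S)

      2m+1-indecomposable : F ≡ suc m → ¬ Decomposable S (suc (m + m))
      2m+1-indecomposable F≡1+m (s , t , s∈S , t∈S , s≢0 , t≢0 , s+t≡1+2m) =
        <-irrefl (trans (sym (cong₂ _+_ s≡m t≡m)) s+t≡1+2m) (n<1+n (m + m))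
        where
          s≡m : s ≡ m
          s≡m = ≤-antisym (summand≤m F≡1+m s∈S (m≤ t∈S t≢0) s+t≡1+2m) (m≤ s∈S s≢0)
          t≡m : t ≡ m
          t≡m = ≤-antisym (summand≤m F≡1+m t∈S (m≤ s∈S s≢0) (trans (+-comm t s) s+t≡1+2m)) (m≤ t∈S t≢0)

      module _ {a r : ℕ} (m+a≡F : m + a ≡ F) (1+F+r≡m+m : suc F + r ≡ m + m) where

        m≡1+a+r : m ≡ suc (a + r)
        m≡1+a+r = +-cancelˡ-≡ m m (suc (a + r)) (begin
          m + m              ≡⟨ 1+F+r≡m+m ⟨
          suc F + r          ≡⟨ cong (λ f → suc f + r) m+a≡F ⟨
          suc (m + a) + r    ≡⟨ cong suc (+-assoc m a r) ⟩
          suc (m + (a + r))  ≡⟨ +-suc m (a + r) ⟨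
          m + suc (a + r)    ∎)
          where open ≡-Reasoning

        below-F : List ℕ
        below-F = interval m a

        above-F : List ℕ
        above-F = interval (suc F) r

        ∈-below-F⁻ : ∀ {x} → x ∈ below-F → m ≤ x × x < F
        ∈-below-F⁻ {x} x∈ = let m≤x , x<m+a = ∈-interval⁻ x∈ in m≤x , subst (x <_) m+a≡F x<m+a

        ∈-above-F⁻ : ∀ {x} → x ∈ above-F → F < x × x < m + m
        ∈-above-F⁻ {x} x∈ = let F<x , x<1+F+r = ∈-interval⁻ x∈ in F<x , subst (x <_) 1+F+r≡m+m x<1+F+r

        ∈-below-F++above-F⇒<m+m : ∀ {x} → x ∈ below-F ++ above-F → x < m + m
        ∈-below-F++above-F⇒<m+m x∈ with ∈-++⁻ below-F x∈
        ... | inj₁ x∈below = <-trans (proj₂ (∈-below-F⁻ x∈below)) F<2m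
        ... | inj₂ x∈above = proj₂ (∈-above-F⁻ x∈above)

        below-F++above-F-atoms : ∀ {x} → x ∈ below-F ++ above-F → Atom S x
        below-F++above-F-atoms x∈ with ∈-++⁻ below-F x∈
        ... | inj₁ x∈below = let m≤x , x<F = ∈-below-F⁻ x∈below
                             in m≤x<F⇒∈S m≤x x<F , m<n⇒n≢0 (<-≤-trans 0<m m≤x) ,
                                below-2m⇒indecomposable (<-trans x<F F<2m)
        ... | inj₂ x∈above = let F<x , x<2m = ∈-above-F⁻ x∈above
                             in F<⇒∈S F<x , m<n⇒n≢0 F<x , below-2m⇒indecomposable x<2m

        below-F++above-F-unique : Unique (below-F ++ above-F)
        below-F++above-F-unique = ++⁺ (interval-unique m a) (interval-unique (suc F) r)
          λ (x∈below , x∈above) → <-asym (proj₂ (∈-below-F⁻ x∈below)) (proj₁ (∈-above-F⁻ x∈above))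

        length-below-F++above-F : length (below-F ++ above-F) ≡ a + r
        length-below-F++above-F =
          trans (length-++ below-F) (cong₂ _+_ (length-applyUpTo (m +_) a) (length-applyUpTo (suc F +_) r))

        a+r≤e : a + r ≤ e
        a+r≤e = subst (_≤ e) length-below-F++above-F
                      (atoms⇒≤e below-F++above-F-unique below-F++above-F-atoms)

        1+a≤n : suc a ≤ n
        1+a≤n = subst (_≤ n) (cong suc (length-applyUpTo (m +_) a)) (elements<F⇒≤n 0∷below-F-unique 0∷below-F⊆)
          where
            0∷below-F-unique : Unique (0 ∷ below-F)
            0∷below-F-unique = All.tabulate (λ x∈ → m<n⇒n≢0 (<-≤-trans 0<m (proj₁ (∈-below-F⁻ x∈))) ∘ sym)
                             ∷ interval-unique m a
            0∷below-F⊆ : ∀ {x} → x ∈ 0 ∷ below-F → x ∈ₛ S × x < F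
            0∷below-F⊆ (here refl) = zero∈ S , n≢0⇒n>0 (gap⇒≢0 S F∉S)
            0∷below-F⊆ (there x∈)  = let m≤x , x<F = ∈-below-F⁻ x∈ in m≤x<F⇒∈S m≤x x<F , x<F

        a≡1⇒2+r≤e : a ≡ 1 → suc (1 + r) ≤ e
        a≡1⇒2+r≤e a≡1 = subst (λ a → suc (a + r) ≤ e) a≡1
          (subst (_≤ e) (cong suc length-below-F++above-F) (atoms⇒≤e 2m+1∷-unique 2m+1∷-atoms))
          where
            F≡1+m : F ≡ suc m
            F≡1+m = trans (sym m+a≡F) (trans (cong (m +_) a≡1) (+-comm m 1))
            2m+1∷-unique : Unique (suc (m + m) ∷ below-F ++ above-F)
            2m+1∷-unique =
              All.tabulate (λ x∈ eq → <-asym (∈-below-F++above-F⇒<m+m x∈) (subst (m + m <_) eq (n<1+n (m + m))))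
              ∷ below-F++above-F-unique
            2m+1∷-atoms : ∀ {x} → x ∈ suc (m + m) ∷ below-F ++ above-F → Atom S x
            2m+1∷-atoms (here refl) =
              F<⇒∈S (subst (_< suc (m + m)) (sym F≡1+m) (s≤s (m<m+n m 0<m))) , (λ ()) , 2m+1-indecomposable F≡1+m
            2m+1∷-atoms (there x∈) = below-F++above-F-atoms x∈

      wilf-m<F : m < F → F + 1 ≤ e * n
      wilf-m<F m<F
        with a , m+a≡F ← m≤n⇒∃[o]m+o≡n (<⇒≤ m<F)
        with r , 1+F+r≡m+m ← m≤n⇒∃[o]m+o≡n F<2m
        with a
      ... | zero = contradiction (trans (sym (+-identityʳ m)) m+a≡F) (<⇒≢ m<F)
      ... | suc zero = wilf-bound-when-a≡1 r e n (m≡1+a+r m+a≡F 1+F+r≡m+m) (sym m+a≡F)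
                         (a≡1⇒2+r≤e m+a≡F 1+F+r≡m+m refl) (1+a≤n m+a≡F 1+F+r≡m+m)
      ... | a@(suc (suc _)) = wilf-bound-when-2≤a a r e n (m≡1+a+r m+a≡F 1+F+r≡m+m) (sym m+a≡F)
                                (s≤s (s≤s z≤n)) (a+r≤e m+a≡F 1+F+r≡m+m) (1+a≤n m+a≡F 1+F+r≡m+m)

      wilf : F + 1 ≤ e * n
      wilf with <-cmp F m
      ... | tri< F<m _ _ = wilf-F<m F<m
      ... | tri≈ _ F≡m _ = contradiction (subst (_∈ₛ S) (sym F≡m) m∈S) F∉S
      ... | tri> _ _ m<F = wilf-m<F m<F

    module AboveTwiceMultiplicity (2m<F : m + m < F) where

      ComplementOfUpperGap : ℕ → Set
      ComplementOfUpperGap k = ∀ g → Gap S g → g + k ≡ F → F < g + g → 0 < k → k ∈ₛ S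

      -- If k ∉ S then g is a special gap above m; for a nonzero s < k with g + s ∉ S,
      -- induction applied to the gap g + s puts k − s, hence k, in S.
      upper-gap-complement : ∀ k → ComplementOfUpperGap k
      upper-gap-complement = <-rec ComplementOfUpperGap step
        where
          step : ∀ k → (∀ {k′} → k′ < k → ComplementOfUpperGap k′) → ComplementOfUpperGap k
          step k IH g g∉S g+k≡F F<g+g 0<k with dec S k
          ... | yes k∈S = k∈S
          ... | no k∉S  = contradiction (special-gap⇒≤m (g∉S , F<x+x⇒2x∈S {g} F<g+g , g+S⊆S) g<F) (<⇒≱ m<g)
            where
              g<F : g < F
              g<F = subst (g <_) g+k≡F (m<m+n g 0<k)
              m<g : m < g
              m<g = ≰⇒> (λ g≤m → <⇒≱ (<-trans 2m<F F<g+g) (+-mono-≤ g≤m g≤m))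
              g+s∉S⇒k∈S : ∀ {s} → s ∈ₛ S → s ≢ 0 → s < k → Gap S (g + s) → k ∈ₛ S
              g+s∉S⇒k∈S {s} s∈S s≢0 s<k g+s∉S =
                subst (_∈ₛ S) (m∸n+n≡m (<⇒≤ s<k)) (closed S (k ∸ s) s k∸s∈S s∈S)
                where
                  k∸s∈S : (k ∸ s) ∈ₛ S
                  k∸s∈S = IH (∸-monoʳ-< (n≢0⇒n>0 s≢0) (<⇒≤ s<k)) (g + s) g+s∉S
                    (trans (+-assoc g s (k ∸ s)) (trans (cong (g +_) (m+[n∸m]≡n (<⇒≤ s<k))) g+k≡F))
                    (<-≤-trans F<g+g (+-mono-≤ (m≤m+n g s) (m≤m+n g s)))
                    (m<n⇒0<n∸m s<k)
              g+S⊆S : ∀ s → s ∈ₛ S → s ≢ 0 → (g + s) ∈ₛ S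
              g+S⊆S s s∈S s≢0 with <-cmp s k | dec S (g + s)
              ... | _              | yes g+s∈S = g+s∈S
              ... | tri< s<k _ _   | no g+s∉S  = contradiction (g+s∉S⇒k∈S s∈S s≢0 s<k g+s∉S) k∉S
              ... | tri≈ _ refl _  | no _      = contradiction s∈S k∉S
              ... | tri> _ _ k<s   | no _      = F<⇒∈S (subst (_< g + s) g+k≡F (+-monoʳ-< g k<s))

      gap-complement : ∀ {x} → x ≤ F → Gap S x → x + x ≢ F → (F ∸ x) ∈ₛ S
      gap-complement {x} x≤F x∉S x+x≢F with <-cmp (x + x) F | m≤n⇒m<n∨m≡n x≤F
      ... | tri≈ _ x+x≡F _ | _        = contradiction x+x≡F x+x≢F
      ... | tri> _ _ F<x+x | inj₂ refl = subst (_∈ₛ S) (sym (n∸n≡0 x)) (zero∈ S)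
      ... | tri> _ _ F<x+x | inj₁ x<F  =
        upper-gap-complement (F ∸ x) x x∉S (m+[n∸m]≡n x≤F) F<x+x (m<n⇒0<n∸m x<F)
      ... | tri< x+x<F _ _ | _ with dec S (F ∸ x)
      ...   | yes F∸x∈S = F∸x∈S
      ...   | no F∸x∉S  =
        contradiction (upper-gap-complement x (F ∸ x) F∸x∉S (m∸n+n≡m x≤F) F<y+y (n≢0⇒n>0 (gap⇒≢0 S x∉S))) x∉S
        where
          x<F∸x : x < F ∸ x
          x<F∸x = +-cancelʳ-< x x (F ∸ x) (subst (x + x <_) (sym (m∸n+n≡m x≤F)) x+x<F)
          F<y+y : F < (F ∸ x) + (F ∸ x)
          F<y+y = subst (_< (F ∸ x) + (F ∸ x)) (m∸n+n≡m x≤F) (+-monoʳ-< (F ∸ x) x<F∸x)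

      half-gap-pseudoFrobenius : ∀ {h} → h + h ≡ F → Gap S h → PseudoFrobenius S h
      half-gap-pseudoFrobenius {h} h+h≡F h∉S = h∉S , h+S⊆S
        where
          h+S⊆S : ∀ s → s ∈ₛ S → s ≢ 0 → (h + s) ∈ₛ S
          h+S⊆S s s∈S s≢0 with dec S (h + s) | h + s ≤? F
          ... | yes h+s∈S | _         = h+s∈S
          ... | no _      | no h+s≰F  = F<⇒∈S (≰⇒> h+s≰F)
          ... | no h+s∉S  | yes h+s≤F = contradiction (subst (_∈ₛ S) (m∸n+n≡m s≤h) (closed S _ s h∸s∈S s∈S)) h∉S
            where
              s≤h : s ≤ h
              s≤h = +-cancelˡ-≤ h s h (subst (h + s ≤_) (sym h+h≡F) h+s≤F)
              h<h+s : h < h + s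
              h<h+s = m<m+n h (n≢0⇒n>0 s≢0)
              h∸s∈S : (h ∸ s) ∈ₛ S
              h∸s∈S = subst (_∈ₛ S) (trans (cong (_∸ (h + s)) (sym h+h≡F)) ([m+n]∸[m+o]≡n∸o h h s))
                (gap-complement h+s≤F h+s∉S (λ eq → <-irrefl (trans h+h≡F (sym eq)) (+-mono-< h<h+s h<h+s)))

      elements-and-complements : List ℕ
      elements-and-complements = l ++ map (F ∸_) l

      length-elements-and-complements : length elements-and-complements ≡ n + n
      length-elements-and-complements = trans (length-++ l) (cong (n +_) (length-map (F ∸_) l))

      ∈elements-and-complements : ∀ {x} → x ≤ F → x ∈ₛ S ⊎ x + x ≢ F → x ∈ elements-and-complements
      ∈elements-and-complements {x} x≤F x∈S⊎x+x≢F with dec S x | x∈S⊎x+x≢F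
      ... | yes x∈S | _ = ∈-++⁺ˡ (proj₂ (enumerates x) (x∈S , ≤∧≢⇒< x≤F λ { refl → F∉S x∈S }))
      ... | no x∉S  | inj₁ x∈S   = contradiction x∈S x∉S
      ... | no x∉S  | inj₂ x+x≢F = ∈-++⁺ʳ l (subst (_∈ map (F ∸_) l) (m∸[m∸n]≡n x≤F) (∈-map⁺ (F ∸_) F∸x∈l))
        where
          F∸x<F : F ∸ x < F
          F∸x<F = ∸-monoʳ-< (n≢0⇒n>0 (gap⇒≢0 S x∉S)) x≤F
          F∸x∈l : (F ∸ x) ∈ l
          F∸x∈l = proj₂ (enumerates (F ∸ x)) (gap-complement x≤F x∉S x+x≢F , F∸x<F)

      upTo-1+F-bound : ∀ {xs} → upTo (suc F) ⊆ xs ++ elements-and-complements → suc F ≤ length xs + (n + n)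
      upTo-1+F-bound {xs} ⊆xs++ = begin
        suc F                                      ≡⟨ length-upTo (suc F) ⟨
        length (upTo (suc F))                      ≤⟨ Unique⇒length-≤ (upTo⁺ (suc F)) ⊆xs++ ⟩
        length (xs ++ elements-and-complements)    ≡⟨ length-++ xs ⟩
        length xs + length elements-and-complements ≡⟨ cong (length xs +_) length-elements-and-complements ⟩
        length xs + (n + n)                        ∎
        where open ≤-Reasoning

      F≤n+n : F ≤ n + n
      F≤n+n = s≤s⁻¹ (upTo-1+F-bound {⌊ F /2⌋ ∷ []} ⊆half∷)
        where
          ⊆half∷ : upTo (suc F) ⊆ ⌊ F /2⌋ ∷ elements-and-complements
          ⊆half∷ {x} x∈ with x + x ≟ F
          ... | yes x+x≡F = here (trans (n≡⌊n+n/2⌋ x) (cong ⌊_/2⌋ x+x≡F))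
          ... | no x+x≢F  = there (∈elements-and-complements (m<1+n⇒m≤n (∈-upTo⁻ x∈)) (inj₂ x+x≢F))

      halves∈S⇒F<n+n : (∀ h → h + h ≡ F → h ∈ₛ S) → F < n + n
      halves∈S⇒F<n+n halves∈S = upTo-1+F-bound {[]} λ {x} x∈ →
        ∈elements-and-complements (m<1+n⇒m≤n (∈-upTo⁻ x∈)) (half∈S⊎ x)
        where
          half∈S⊎ : ∀ x → x ∈ₛ S ⊎ x + x ≢ F
          half∈S⊎ x with x + x ≟ F
          ... | yes x+x≡F = inj₁ (halves∈S x x+x≡F)
          ... | no x+x≢F  = inj₂ x+x≢F

      wilf : F + 1 ≤ e * n
      wilf with 3 ≤? e
      ... | yes 3≤e = begin
        F + 1              ≤⟨ +-mono-≤ F≤n+n 1≤n ⟩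
        n + n + n          ≡⟨ solve 1 (λ n → n :+ n :+ n := con 3 :* n) refl n ⟩
        3 * n              ≤⟨ *-monoˡ-≤ n 3≤e ⟩
        e * n              ∎
        where
          open ≤-Reasoning
          open +-*-Solver
      ... | no 3≰e = begin
        F + 1              ≡⟨ +-comm F 1 ⟩
        suc F              ≤⟨ halves∈S⇒F<n+n halves∈S ⟩
        n + n              ≡⟨ cong (n +_) (+-identityʳ n) ⟨
        2 * n              ≤⟨ *-monoˡ-≤ n (pseudoFrobenius⇒2≤length S generates F-pseudoFrobenius) ⟩
        e * n              ∎
        where
          open ≤-Reasoning
          halves∈S : ∀ h → h + h ≡ F → h ∈ₛ S
          halves∈S h h+h≡F with dec S h
          ... | yes h∈S = h∈S
          ... | no h∉S  = contradiction (pseudoFrobenius⇒3≤length S generates h-pseudoFrobenius 2h∉S) 3≰e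
            where
              h-pseudoFrobenius : PseudoFrobenius S h
              h-pseudoFrobenius = half-gap-pseudoFrobenius h+h≡F h∉S
              2h∉S : Gap S (h + h)
              2h∉S = subst (Gap S) (sym h+h≡F) F∉S

    wilf : F + 1 ≤ e * n
    wilf with <-cmp (m + m) F
    ... | tri< 2m<F _ _ = AboveTwiceMultiplicity.wilf 2m<F
    ... | tri≈ _ 2m≡F _ = contradiction (subst (_∈ₛ S) 2m≡F (closed S m m m∈S m∈S)) F∉S
    ... | tri> _ _ F<2m = BelowTwiceMultiplicity.wilf F<2m

  special⇒wilf : (S : NumericalSemigroup) → IsSpecial S → ∀ {F e n} → Gap S F → (∀ x → Gap S x → x ≤ F) →
                 IsEmbeddingDimension S e → HasCard (λ s → s ∈ₛ S × s < F) n → F + 1 ≤ e * n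
  special⇒wilf S special F∉S gap⇒≤F (A , (_ , generates , _) , refl) (l , _ , enumerates , refl) =
    Special.wilf S special F∉S gap⇒≤F (proj₂ (multiplicity S)) generates enumerates

open import Data.Nat using (ℕ; _*_; z≤n)
open import Data.Integer using (ℤ; +_; _+_; _≤_; +≤+)
open import Data.Product using (_,_)
open import Data.Sum using (inj₁; inj₂)
open import Relation.Binary.PropositionalEquality using (refl)

proposition3p8 : (S : NumericalSemigroup) → IsSpecial S →
    (f : ℤ) (e n : ℕ) → IsFrobenius S f → IsEmbeddingDimension S e → IsN S f n →
    f + + 1 ≤ + (e * n)
proposition3p8 S special f e n (inj₁ (refl , _)) _ _ = +≤+ z≤n
proposition3p8 S special f e n (inj₂ (F , refl , _ , _)) _ (inj₁ (() , _))
proposition3p8 S special f e n (inj₂ (F , refl , F∉S , gap⇒≤F)) embedding (inj₂ (_ , refl , card)) =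
  +≤+ (Wilf.special⇒wilf S special F∉S gap⇒≤F embedding card)
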